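{- Let $G$ be a connected graph of order $n$ with stability number $\alpha$ such that $F(G)\ge F(H)$ for every connected graph $H$ of order $n$ with stability number $\alpha$. Then either $G$ is $\alpha$-critical or $G$ has an $\alpha$-critical decomposition.
   Context: Graphs are finite, simple, undirected. $\alpha(G)$ is the stability number; $F(G)$ is the number of stable sets of $G$ (including the empty set). For an edge $e$, $G-e$ is $G$ with $e$ removed. An edge $e$ is $\alpha$-critical if $\alpha(G-e)>\alpha(G)$ and $\alpha$-safe otherwise; $G$ is $\alpha$-critical if all its edges are $\alpha$-critical (a graph with no edges is $\alpha$-critical). A bridge of a connected graph $G$ is an edge $e$ such that $G-e$ is disconnected. To an $\alpha$-safe bridge $e=v_1v_2$ of $G$ one associates a decomposition $(G_1,v_1,G_2,v_2)$, where $G_1,G_2$ are the two connected components of $G-e$ with $v_1\in V(G_1)$, $v_2\in V(G_2)$. A decomposition is $\alpha$-critical if $G_1$ is $\alpha$-critical. -}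

module Defs where

open import Data.Nat using (ℕ; zero; suc; _<_; _⊔_)
open import Data.Bool using (Bool; true; false; _∧_; _∨_; not; if_then_else_)
open import Data.Bool.Properties using (∧-comm; ∨-comm)
open import Data.Fin using (Fin; _≟_)
open import Data.Fin.Subset using (Subset; ∣_∣)
open import Data.Vec using (Vec; []; _∷_; lookup)
open import Data.List using (List; []; _∷_; _++_; map; foldr; allFin)
open import Data.Nat.ListAction using (sum)
open import Data.Bool.ListAction using (all)
open import Data.Product using (Σ; _×_)
open import Relation.Nullary using (¬_; ⌊_⌋)
open import Relation.Binary.PropositionalEquality using (_≡_; refl; cong₂; trans)
open import Function.Bundles using (_⇔_)

record Graph (n : ℕ) : Set where
  field
    adj    : Fin n → Fin n → Bool
    sym    : ∀ i j → adj i j ≡ adj j i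
    irrefl : ∀ i → adj i i ≡ false
open Graph public

private
  isPair : ∀ {n} → Fin n → Fin n → Fin n → Fin n → Bool
  isPair u v i j = (⌊ i ≟ u ⌋ ∧ ⌊ j ≟ v ⌋) ∨ (⌊ i ≟ v ⌋ ∧ ⌊ j ≟ u ⌋)

  isPair-sym : ∀ {n} (u v i j : Fin n) → isPair u v i j ≡ isPair u v j i
  isPair-sym u v i j =
    trans (cong₂ _∨_ (∧-comm ⌊ i ≟ u ⌋ ⌊ j ≟ v ⌋) (∧-comm ⌊ i ≟ v ⌋ ⌊ j ≟ u ⌋))
          (∨-comm (⌊ j ≟ v ⌋ ∧ ⌊ i ≟ u ⌋) (⌊ j ≟ u ⌋ ∧ ⌊ i ≟ v ⌋))

removeEdge : ∀ {n} → Graph n → Fin n → Fin n → Graph n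
adj (removeEdge G u v) i j = adj G i j ∧ not (isPair u v i j)
sym (removeEdge G u v) i j = cong₂ (λ a b → a ∧ not b) (sym G i j) (isPair-sym u v i j)
irrefl (removeEdge G u v) i with adj G i i | irrefl G i
... | .false | refl = refl

allSubsets : ∀ n → List (Subset n)
allSubsets zero = [] ∷ []
allSubsets (suc n) = map (true ∷_) (allSubsets n) ++ map (false ∷_) (allSubsets n)

isStable : ∀ {n} → Graph n → Subset n → Bool
isStable {n} G S =
  all (λ i → all (λ j → not (lookup S i ∧ lookup S j ∧ adj G i j)) (allFin n)) (allFin n)

isSubsetOf : ∀ {n} → Subset n → Subset n → Bool
isSubsetOf {n} S T = all (λ i → not (lookup S i) ∨ lookup T i) (allFin n)

F : ∀ {n} → Graph n → ℕ
F {n} G = sum (map (λ S → if isStable G S then 1 else 0) (allSubsets n))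

α : ∀ {n} → Graph n → ℕ
α {n} G = foldr _⊔_ 0 (map (λ S → if isStable G S then ∣ S ∣ else 0) (allSubsets n))

αIn : ∀ {n} → Graph n → Subset n → ℕ
αIn {n} G T =
  foldr _⊔_ 0 (map (λ S → if isStable G S ∧ isSubsetOf S T then ∣ S ∣ else 0) (allSubsets n))

data Reachable {n} (G : Graph n) : Fin n → Fin n → Set where
  here : ∀ {u} → Reachable G u u
  step : ∀ {u w v} → adj G u w ≡ true → Reachable G w v → Reachable G u v

Connected : ∀ {n} → Graph n → Set
Connected {n} G = ∀ (u v : Fin n) → Reachable G u v

AlphaCriticalEdge : ∀ {n} → Graph n → Fin n → Fin n → Set
AlphaCriticalEdge G u v = α G < α (removeEdge G u v)

AlphaCritical : ∀ {n} → Graph n → Set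
AlphaCritical {n} G = ∀ (u v : Fin n) → adj G u v ≡ true → AlphaCriticalEdge G u v

AlphaCriticalOn : ∀ {n} → Graph n → Subset n → Set
AlphaCriticalOn {n} G T =
  ∀ (x y : Fin n) → lookup T x ≡ true → lookup T y ≡ true → adj G x y ≡ true →
  αIn G T < αIn (removeEdge G x y) T

-- e = v₁v₂ is a bridge of G (G connected assumed separately).
IsBridge : ∀ {n} → Graph n → Fin n → Fin n → Set
IsBridge G v₁ v₂ = adj G v₁ v₂ ≡ true × ¬ Connected (removeEdge G v₁ v₂)

-- G has an α-critical decomposition (G₁ , v₁ , G₂ , v₂): there is an α-safe
-- bridge e = v₁v₂ such that the component G₁ of G - e containing v₁
-- (vertex set T) is α-critical.
HasAlphaCriticalDecomposition : ∀ {n} → Graph n → Set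
HasAlphaCriticalDecomposition {n} G =
  Σ (Fin n) λ v₁ → Σ (Fin n) λ v₂ →
    IsBridge G v₁ v₂ × ¬ AlphaCriticalEdge G v₁ v₂ ×
    Σ (Subset n) λ T →
      (∀ w → (lookup T w ≡ true) ⇔ Reachable (removeEdge G v₁ v₂) v₁ w) ×
      AlphaCriticalOn (removeEdge G v₁ v₂) T

module Submission where

-- Deleting an edge e never decreases α and strictly
-- increases F (the two ends of e become a new stable set), so if e is α-safe
-- then G - e must be disconnected: every α-safe edge of G is a bridge.
--
-- If G is not α-critical, pick an α-safe edge uv and let side(u,v) be the
-- component of u in G - uv.  If every edge of G - uv inside side(u,v) is
-- α-critical in G, then (G - uv)[side(u,v)] is α-critical, because
--   (i)  α-critical edges of G stay α-critical in G - uv (uv is α-safe), and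
--   (ii) an α-critical edge of a graph K with an end in a union T of
--        components of K is α-critical in K[T] (split a large stable set of
--        K - xy along T and its complement).
-- Otherwise there is an α-safe edge xy inside side(u,v); it is again a
-- bridge, and orienting it away from v gives side(x,y) ⊂ side(u,v).
-- Induction on |side(u,v)| yields an α-critical decomposition.

open import Defs hiding (sym)
open import Data.Nat using (ℕ; zero; suc; _≤_; _<_; _⊔_; _+_; z≤n; s≤s; _<?_)
open import Data.Nat.Properties
  using (≤-refl; ≤-trans; <-≤-trans; ≤-reflexive; ≤-pred; <⇒≱; ≮⇒≥;
         ≤-antisym; m<m+n; m≤m⊔n; m≤n⊔m; ⊔-sel; +-suc; +-monoʳ-≤; +-monoˡ-≤;
         +-mono-≤; +-mono-<-≤; +-mono-≤-<; +-cancelʳ-<; module ≤-Reasoning)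
open import Data.Bool using (Bool; true; false; _∧_; _∨_; not; if_then_else_)
open import Data.Bool.Properties using (T-≡; ∧-conicalˡ; ∧-conicalʳ; ∧-zeroʳ; ∧-identityʳ; ∨-comm; not-injective)
  renaming (_≟_ to _≟ᵇ_)
open import Data.Bool.ListAction using (all)
open import Data.Fin using (Fin; _≟_)
open import Data.Fin.Properties using (any?)
open import Data.Fin.Subset using (Subset; ∣_∣; _∈_; _∉_; _⊆_; _⊂_; _∩_; _∪_; ∁; ⊥; ⁅_⁆)
open import Data.Fin.Subset.Properties
  using (_∈?_; _⊂?_; p⊂q⇒∣p∣<∣q∣; ∣p∣≤n; p⊆p∪q; x∈p∪q⁻; x∈p∩q⁻; x∈∁p⇒x∉p;
         q⊆p∪q; ∉⊥; ⊥⊆; ∣⊥∣≡0; x∈⁅x⁆; x∈⁅y⁆⇒x≡y; ∣⁅x⁆∣≡1)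
open import Data.Vec using ([]; _∷_; lookup; tabulate; here; there)
open import Data.Vec.Properties using (lookup∘tabulate; []=⇒lookup; lookup⇒[]=)
open import Data.List using (List; []; _∷_; map; foldr; allFin)
open import Data.Nat.ListAction using (sum)
open import Data.List.Membership.Propositional using () renaming (_∈_ to _∈ₗ_)
open import Data.List.Membership.Propositional.Properties using (∈-allFin; ∈-++⁺ˡ; ∈-++⁺ʳ; ∈-map⁺)
import Data.List.Relation.Unary.Any as Any
import Data.List.Relation.Unary.All as All
open import Data.List.Relation.Unary.All.Properties using (all⁺; all⁻)
open import Data.Product using (∃; ∃₂; _×_; _,_; proj₁; proj₂)
open import Data.Sum using (_⊎_; inj₁; inj₂)
open import Data.Empty using (⊥-elim)
open import Relation.Nullary using (¬_; Dec; yes; no; does; ⌊_⌋; ¬?; _×-dec_; _⊎-dec_; contradiction)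
open import Relation.Nullary.Decidable using (decidable-stable)
open import Relation.Unary using (Decidable)
open import Relation.Binary.PropositionalEquality using (_≡_; refl; sym; trans; cong; cong₂; subst)
open import Function.Base using (_∘_)
open import Function.Bundles using (_⇔_; mk⇔; Equivalence)

open Equivalence using (to; from)

private
  variable
    n : ℕ

∈⇔lookup : ∀ {x : Fin n} {p : Subset n} → x ∈ p ⇔ lookup p x ≡ true
∈⇔lookup {x = x} {p} = mk⇔ []=⇒lookup (lookup⇒[]= x p)

all-≡true⇔ : ∀ {A : Set} (p : A → Bool) (xs : List A) →
             all p xs ≡ true ⇔ (∀ {x} → x ∈ₗ xs → p x ≡ true)
all-≡true⇔ p xs = mk⇔ sound complete
  where
  sound : all p xs ≡ true → ∀ {x} → x ∈ₗ xs → p x ≡ true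
  sound h x∈ = to T-≡ (All.lookup (all⁺ p xs (from T-≡ h)) x∈)
  complete : (∀ {x} → x ∈ₗ xs → p x ≡ true) → all p xs ≡ true
  complete h = to T-≡ (all⁻ p (All.tabulate (λ x∈ → from T-≡ (h x∈))))

all-allFin⇔ : ∀ (p : Fin n → Bool) → all p (allFin n) ≡ true ⇔ (∀ i → p i ≡ true)
all-allFin⇔ {n} p = mk⇔ (λ h i → to (all-≡true⇔ p (allFin n)) h (∈-allFin i))
                        (λ h → from (all-≡true⇔ p (allFin n)) (λ {i} _ → h i))

select : ∀ {P : Fin n → Set} → Decidable P → Subset n
select P? = tabulate (does ∘ P?)

∈-select⇔ : ∀ {P : Fin n → Set} (P? : Decidable P) {x} → x ∈ select P? ⇔ P x
∈-select⇔ {P = P} P? {x} = mk⇔ sound complete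
  where
  lookup-select : lookup (select P?) x ≡ does (P? x)
  lookup-select = lookup∘tabulate (does ∘ P?) x
  sound : x ∈ select P? → P x
  sound x∈ with P? x | trans (sym lookup-select) (to ∈⇔lookup x∈)
  ... | yes px | _ = px
  ... | no _   | ()
  complete : P x → x ∈ select P?
  complete px with P? x | lookup-select
  ... | yes _  | eq = from ∈⇔lookup eq
  ... | no ¬px | _  = contradiction px ¬px

∣p∣≡∣p∩q∣+∣p∩∁q∣ : ∀ (p q : Subset n) → ∣ p ∣ ≡ ∣ p ∩ q ∣ + ∣ p ∩ ∁ q ∣
∣p∣≡∣p∩q∣+∣p∩∁q∣ []          []          = refl
∣p∣≡∣p∩q∣+∣p∩∁q∣ (false ∷ p) (_ ∷ q)     = ∣p∣≡∣p∩q∣+∣p∩∁q∣ p q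
∣p∣≡∣p∩q∣+∣p∩∁q∣ (true ∷ p)  (true ∷ q)  = cong suc (∣p∣≡∣p∩q∣+∣p∩∁q∣ p q)
∣p∣≡∣p∩q∣+∣p∩∁q∣ (true ∷ p)  (false ∷ q) =
  trans (cong suc (∣p∣≡∣p∩q∣+∣p∩∁q∣ p q)) (sym (+-suc _ _))

Disjoint : Subset n → Subset n → Set
Disjoint p q = ∀ {x} → x ∈ p → x ∉ q

Disjoint-tail : ∀ {s t} {p q : Subset n} → Disjoint (s ∷ p) (t ∷ q) → Disjoint p q
Disjoint-tail d x∈p x∈q = d (there x∈p) (there x∈q)

∣p∪q∣≡∣p∣+∣q∣ : ∀ (p q : Subset n) → Disjoint p q → ∣ p ∪ q ∣ ≡ ∣ p ∣ + ∣ q ∣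
∣p∪q∣≡∣p∣+∣q∣ []          []          _ = refl
∣p∪q∣≡∣p∣+∣q∣ (true ∷ p)  (true ∷ q)  d = contradiction here (d here)
∣p∪q∣≡∣p∣+∣q∣ (false ∷ p) (false ∷ q) d = ∣p∪q∣≡∣p∣+∣q∣ p q (Disjoint-tail d)
∣p∪q∣≡∣p∣+∣q∣ (true ∷ p)  (false ∷ q) d = cong suc (∣p∪q∣≡∣p∣+∣q∣ p q (Disjoint-tail d))
∣p∪q∣≡∣p∣+∣q∣ (false ∷ p) (true ∷ q)  d =
  trans (cong suc (∣p∪q∣≡∣p∣+∣q∣ p q (Disjoint-tail d))) (sym (+-suc _ _))

∈-allSubsets : ∀ (S : Subset n) → S ∈ₗ allSubsets n
∈-allSubsets []          = Any.here refl
∈-allSubsets {suc n} (true ∷ S)  = ∈-++⁺ˡ (∈-map⁺ (true ∷_) (∈-allSubsets S))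
∈-allSubsets {suc n} (false ∷ S) =
  ∈-++⁺ʳ (map (true ∷_) (allSubsets n)) (∈-map⁺ (false ∷_) (∈-allSubsets S))

⊔-fold-ub : ∀ {A : Set} (f : A → ℕ) (xs : List A) {x} →
            x ∈ₗ xs → f x ≤ foldr _⊔_ 0 (map f xs)
⊔-fold-ub f (y ∷ ys) (Any.here refl) = m≤m⊔n (f y) _
⊔-fold-ub f (y ∷ ys) (Any.there x∈)  = ≤-trans (⊔-fold-ub f ys x∈) (m≤n⊔m (f y) _)

⊔-fold-sel : ∀ {A : Set} (f : A → ℕ) (xs : List A) →
             foldr _⊔_ 0 (map f xs) ≡ 0 ⊎ ∃ λ x → foldr _⊔_ 0 (map f xs) ≡ f x
⊔-fold-sel f []       = inj₁ refl
⊔-fold-sel f (y ∷ ys) with ⊔-sel (f y) (foldr _⊔_ 0 (map f ys)) | ⊔-fold-sel f ys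
... | inj₁ eq | _              = inj₂ (y , eq)
... | inj₂ eq | inj₁ none      = inj₁ (trans eq none)
... | inj₂ eq | inj₂ (x , max) = inj₂ (x , trans eq max)

-- The largest size of a subset passing a Boolean test; both α and αIn
-- unfold to this.
largest : (Subset n → Bool) → ℕ
largest {n} P = foldr _⊔_ 0 (map (λ S → if P S then ∣ S ∣ else 0) (allSubsets n))

largest-ub : ∀ (P : Subset n → Bool) {S} → P S ≡ true → ∣ S ∣ ≤ largest P
largest-ub {n} P {S} PS with ⊔-fold-ub (λ S → if P S then ∣ S ∣ else 0) (allSubsets n) (∈-allSubsets S)
... | bound rewrite PS = bound

largest-attained : ∀ (P : Subset n → Bool) → P ⊥ ≡ true →
                   ∃ λ S → P S ≡ true × largest P ≤ ∣ S ∣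
largest-attained {n} P P⊥ with ⊔-fold-sel (λ S → if P S then ∣ S ∣ else 0) (allSubsets n)
... | inj₁ none = ⊥ , P⊥ , ≤-reflexive (trans none (sym (∣⊥∣≡0 n)))
... | inj₂ (S , max) with P S in PS
...   | true  = S , PS , ≤-reflexive max
...   | false = ⊥ , P⊥ , ≤-reflexive (trans max (sym (∣⊥∣≡0 n)))

Stable : Graph n → Subset n → Set
Stable G S = ∀ {i j} → i ∈ S → j ∈ S → adj G i j ≡ false

isStable⇔ : ∀ (G : Graph n) (S : Subset n) → isStable G S ≡ true ⇔ Stable G S
isStable⇔ G S = mk⇔ sound complete
  where
  sound : isStable G S ≡ true → Stable G S
  sound h {i} {j} i∈ j∈ with to (all-allFin⇔ _) (to (all-allFin⇔ _) h i) j
  ... | pair rewrite to ∈⇔lookup i∈ | to ∈⇔lookup j∈ = not-injective pair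
  pairwise : Stable G S → ∀ i j → not (lookup S i ∧ lookup S j ∧ adj G i j) ≡ true
  pairwise st i j with lookup S i in si | lookup S j in sj
  ... | false | _     = refl
  ... | true  | false = refl
  ... | true  | true  = cong not (st (from ∈⇔lookup si) (from ∈⇔lookup sj))
  complete : Stable G S → isStable G S ≡ true
  complete st = from (all-allFin⇔ _) λ i → from (all-allFin⇔ _) (pairwise st i)

isSubsetOf⇔ : ∀ (S T : Subset n) → isSubsetOf S T ≡ true ⇔ S ⊆ T
isSubsetOf⇔ S T = mk⇔ sound complete
  where
  sound : isSubsetOf S T ≡ true → S ⊆ T
  sound h {i} i∈ with to (all-allFin⇔ _) h i
  ... | member rewrite to ∈⇔lookup i∈ = from ∈⇔lookup member
  pointwise : S ⊆ T → ∀ i → not (lookup S i) ∨ lookup T i ≡ true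
  pointwise sub i with lookup S i in si
  ... | false = refl
  ... | true  = to ∈⇔lookup (sub (from ∈⇔lookup si))
  complete : S ⊆ T → isSubsetOf S T ≡ true
  complete sub = from (all-allFin⇔ _) (pointwise sub)

⊥-stable : ∀ (G : Graph n) → Stable G ⊥
⊥-stable G i∈ = contradiction i∈ ∉⊥

α-ub : ∀ (G : Graph n) {S} → Stable G S → ∣ S ∣ ≤ α G
α-ub G {S} st = largest-ub (isStable G) {S} (from (isStable⇔ G S) st)

α-attained : ∀ (G : Graph n) → ∃ λ S → Stable G S × α G ≤ ∣ S ∣
α-attained G with largest-attained (isStable G) (from (isStable⇔ G ⊥) (⊥-stable G))
... | S , stable , max = S , to (isStable⇔ G S) stable , max

αIn-ub : ∀ (G : Graph n) (T : Subset n) {S} → Stable G S → S ⊆ T → ∣ S ∣ ≤ αIn G T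
αIn-ub G T {S} st sub =
  largest-ub (λ S → isStable G S ∧ isSubsetOf S T) {S}
    (cong₂ _∧_ (from (isStable⇔ G S) st) (from (isSubsetOf⇔ S T) sub))

αIn-attained : ∀ (G : Graph n) (T : Subset n) →
               ∃ λ S → Stable G S × S ⊆ T × αIn G T ≤ ∣ S ∣
αIn-attained G T
  with largest-attained (λ S → isStable G S ∧ isSubsetOf S T)
         (cong₂ _∧_ (from (isStable⇔ G ⊥) (⊥-stable G)) (from (isSubsetOf⇔ ⊥ T) ⊥⊆))
... | S , ok , max =
  S , to (isStable⇔ G S) (∧-conicalˡ _ _ ok) , to (isSubsetOf⇔ S T) (∧-conicalʳ _ _ ok) , max

_⊑_ : Graph n → Graph n → Set
H ⊑ G = ∀ {i j} → adj H i j ≡ true → adj G i j ≡ true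

stable-⊆ : ∀ (G : Graph n) {A B} → A ⊆ B → Stable G B → Stable G A
stable-⊆ G A⊆B st i∈ j∈ = st (A⊆B i∈) (A⊆B j∈)

stable-⊑ : ∀ {H G : Graph n} {S} → H ⊑ G → Stable G S → Stable H S
stable-⊑ {H = H} H⊑G st {i} {j} i∈ j∈ with adj H i j in e
... | false = refl
... | true  = trans (sym (H⊑G e)) (st i∈ j∈)

stable-∪ : ∀ (G : Graph n) {A B} → Stable G A → Stable G B →
           (∀ {i j} → i ∈ A → j ∈ B → adj G i j ≡ false) → Stable G (A ∪ B)
stable-∪ G {A} {B} stA stB cross {i} {j} i∈ j∈ with x∈p∪q⁻ A B i∈ | x∈p∪q⁻ A B j∈
... | inj₁ i∈A | inj₁ j∈A = stA i∈A j∈A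
... | inj₂ i∈B | inj₂ j∈B = stB i∈B j∈B
... | inj₁ i∈A | inj₂ j∈B = cross i∈A j∈B
... | inj₂ i∈B | inj₁ j∈A = trans (Graph.sym G i j) (cross j∈A i∈B)

α-anti : ∀ {H G : Graph n} → H ⊑ G → α G ≤ α H
α-anti {H = H} {G} H⊑G with α-attained G
... | S , st , max = ≤-trans max (α-ub H {S} (stable-⊑ {H = H} {G} H⊑G st))

sum-map-≤ : ∀ {A : Set} (f g : A → ℕ) (xs : List A) →
            (∀ x → f x ≤ g x) → sum (map f xs) ≤ sum (map g xs)
sum-map-≤ f g []       f≤g = z≤n
sum-map-≤ f g (x ∷ xs) f≤g = +-mono-≤ (f≤g x) (sum-map-≤ f g xs f≤g)

sum-map-< : ∀ {A : Set} (f g : A → ℕ) (xs : List A) → (∀ x → f x ≤ g x) →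
            ∀ {y} → y ∈ₗ xs → f y < g y → sum (map f xs) < sum (map g xs)
sum-map-< f g (x ∷ xs) f≤g (Any.here refl) lt = +-mono-<-≤ lt (sum-map-≤ f g xs f≤g)
sum-map-< f g (x ∷ xs) f≤g (Any.there y∈)  lt = +-mono-≤-< (f≤g x) (sum-map-< f g xs f≤g y∈ lt)

F-strict : ∀ {H G : Graph n} {S} → H ⊑ G → Stable H S → ¬ Stable G S → F G < F H
F-strict {n} {H} {G} {S} H⊑G stH ¬stG =
  sum-map-< count[ G ] count[ H ] (allSubsets n) pointwise (∈-allSubsets S) atS
  where
  count[_] : Graph n → Subset n → ℕ
  count[ K ] A = if isStable K A then 1 else 0
  pointwise : ∀ A → count[ G ] A ≤ count[ H ] A
  pointwise A with isStable G A in e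
  ... | false = z≤n
  ... | true rewrite from (isStable⇔ H A) (stable-⊑ {H = H} {G} H⊑G (to (isStable⇔ G A) e)) = ≤-refl
  atS : count[ G ] S < count[ H ] S
  atS rewrite from (isStable⇔ H S) stH with isStable G S in e
  ... | false = s≤s z≤n
  ... | true  = ⊥-elim (¬stG (to (isStable⇔ G S) e))

-- The test used by removeEdge: is {i,j} the pair {u,v}?  (Same definition as
-- in Defs, so adj (removeEdge G u v) i j unfolds to adj G i j ∧ not (isPair u v i j).)
isPair : Fin n → Fin n → Fin n → Fin n → Bool
isPair u v i j = (⌊ i ≟ u ⌋ ∧ ⌊ j ≟ v ⌋) ∨ (⌊ i ≟ v ⌋ ∧ ⌊ j ≟ u ⌋)

SameEdge : Fin n → Fin n → Fin n → Fin n → Set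
SameEdge u v i j = (i ≡ u × j ≡ v) ⊎ (i ≡ v × j ≡ u)

isPair-sound : ∀ (u v i j : Fin n) → isPair u v i j ≡ true → SameEdge u v i j
isPair-sound u v i j with i ≟ u | j ≟ v | i ≟ v | j ≟ u
... | yes i≡u | yes j≡v | _       | _       = λ _ → inj₁ (i≡u , j≡v)
... | _       | _       | yes i≡v | yes j≡u = λ _ → inj₂ (i≡v , j≡u)
... | no _    | _       | no _    | _       = λ ()
... | no _    | _       | yes _   | no _    = λ ()
... | yes _   | no _    | no _    | _       = λ ()
... | yes _   | no _    | yes _   | no _    = λ ()

isPair-self : ∀ (u v : Fin n) → isPair u v u v ≡ true
isPair-self u v with u ≟ u | v ≟ v
... | yes _ | yes _ = refl
... | no u≢u | _    = contradiction refl u≢u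
... | _ | no v≢v    = contradiction refl v≢v

removeEdge-⊑ : ∀ (G : Graph n) u v → removeEdge G u v ⊑ G
removeEdge-⊑ G u v = ∧-conicalˡ _ _

removeEdge-removes : ∀ (G : Graph n) u v → adj (removeEdge G u v) u v ≡ false
removeEdge-removes G u v =
  trans (cong (λ b → adj G u v ∧ not b) (isPair-self u v)) (∧-zeroʳ (adj G u v))

removeEdge-edge : ∀ (G : Graph n) u v {i j} → adj G i j ≡ true →
                  adj (removeEdge G u v) i j ≡ true ⊎ SameEdge u v i j
removeEdge-edge G u v {i} {j} e with isPair u v i j in eq
... | true  = inj₂ (isPair-sound u v i j eq)
... | false = inj₁ (trans (∧-identityʳ _) e)

removeEdge-mono : ∀ {H G : Graph n} x y → H ⊑ G → removeEdge H x y ⊑ removeEdge G x y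
removeEdge-mono x y H⊑G e = cong₂ _∧_ (H⊑G (∧-conicalˡ _ _ e)) (∧-conicalʳ _ _ e)

removeEdge-swap : ∀ (G : Graph n) u v → removeEdge G u v ⊑ removeEdge G v u
removeEdge-swap G u v {i} {j} =
  subst (λ b → adj G i j ∧ not b ≡ true)
        (∨-comm (⌊ i ≟ u ⌋ ∧ ⌊ j ≟ v ⌋) (⌊ i ≟ v ⌋ ∧ ⌊ j ≟ u ⌋))

-- Deleting an edge uv strictly increases F: {u,v} becomes stable.
F-removeEdge : ∀ (G : Graph n) u v → adj G u v ≡ true → F G < F (removeEdge G u v)
F-removeEdge G u v e =
  F-strict {H = removeEdge G u v} {G} (removeEdge-⊑ G u v) pair-stable pair-unstable
  where
  G-uv : Graph _
  G-uv = removeEdge G u v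
  endpoint? : Decidable (λ w → w ≡ u ⊎ w ≡ v)
  endpoint? w = (w ≟ u) ⊎-dec (w ≟ v)
  pair : Subset _
  pair = select endpoint?
  u∈pair : u ∈ pair
  u∈pair = from (∈-select⇔ endpoint?) (inj₁ refl)
  v∈pair : v ∈ pair
  v∈pair = from (∈-select⇔ endpoint?) (inj₂ refl)
  pair-stable : Stable G-uv pair
  pair-stable i∈ j∈ with to (∈-select⇔ endpoint?) i∈ | to (∈-select⇔ endpoint?) j∈
  ... | inj₁ refl | inj₁ refl = Graph.irrefl G-uv u
  ... | inj₂ refl | inj₂ refl = Graph.irrefl G-uv v
  ... | inj₁ refl | inj₂ refl = removeEdge-removes G u v
  ... | inj₂ refl | inj₁ refl = trans (Graph.sym G-uv v u) (removeEdge-removes G u v)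
  pair-unstable : ¬ Stable G pair
  pair-unstable st with trans (sym e) (st u∈pair v∈pair)
  ... | ()

_◅◅_ : ∀ {G : Graph n} {a b c} → Reachable G a b → Reachable G b c → Reachable G a c
here       ◅◅ q = q
step e p   ◅◅ q = step e (p ◅◅ q)

edge : ∀ {G : Graph n} {a b} → adj G a b ≡ true → Reachable G a b
edge e = step e here

reverse : ∀ {G : Graph n} {a b} → Reachable G a b → Reachable G b a
reverse here = here
reverse {G = G} (step {u} {w} e p) = reverse p ◅◅ edge (trans (Graph.sym G w u) e)

reach-⊑ : ∀ {H G : Graph n} → H ⊑ G → ∀ {a b} → Reachable H a b → Reachable G a b
reach-⊑ H⊑G here       = here
reach-⊑ H⊑G (step e p) = step (H⊑G e) (reach-⊑ H⊑G p)

-- If x still reaches y in G - xy, then G - xy is connected whenever G is: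
-- a walk of G crossing xy can detour along the walk from x to y.
reconnect : ∀ (G : Graph n) x y → Connected G →
            Reachable (removeEdge G x y) x y → Connected (removeEdge G x y)
reconnect G x y connected detour a b = reroute (connected a b)
  where
  reroute : ∀ {a b} → Reachable G a b → Reachable (removeEdge G x y) a b
  reroute here = here
  reroute (step e p) with removeEdge-edge G x y e
  ... | inj₁ kept              = step kept (reroute p)
  ... | inj₂ (inj₁ (refl , refl)) = detour ◅◅ reroute p
  ... | inj₂ (inj₂ (refl , refl)) = reverse detour ◅◅ reroute p

-- In a spanning subgraph H of G, a walk from x never crosses the edge uv of G
-- if v is unreachable from x in H (crossing it would reach v).
avoid : ∀ {H G : Graph n} {x u v w} → H ⊑ G → ¬ Reachable H x v →
        Reachable H x w → Reachable (removeEdge G u v) x w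
avoid {H = H} {G} {x} {u} {v} H⊑G x↛v = go here
  where
  go : ∀ {a w} → Reachable H x a → Reachable H a w → Reachable (removeEdge G u v) a w
  go x→a here = here
  go x→a (step e p) with removeEdge-edge G u v (H⊑G e)
  ... | inj₁ kept              = step kept (go (x→a ◅◅ edge e) p)
  ... | inj₂ (inj₁ (_ , refl)) = contradiction (x→a ◅◅ edge e) x↛v
  ... | inj₂ (inj₂ (refl , _)) = contradiction x→a x↛v

-- Vertex sets with no edge leaving them, i.e. unions of components.
Closed : Graph n → Subset n → Set
Closed H R = ∀ {z w} → z ∈ R → adj H z w ≡ true → w ∈ R

closed-reach : ∀ {H : Graph n} {R a b} → Closed H R → a ∈ R → Reachable H a b → b ∈ R
closed-reach closed a∈ here       = a∈
closed-reach closed a∈ (step e p) = closed-reach closed (closed a∈ e) p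

-- The component of a vertex, computed by adding neighbours until nothing
-- new appears (at most n rounds, since each round enlarges the set).
module Component {n} (H : Graph n) where

  adjacentTo? : ∀ R → Decidable (λ w → ∃ λ z → z ∈ R × adj H z w ≡ true)
  adjacentTo? R w = any? (λ z → (z ∈? R) ×-dec (adj H z w ≟ᵇ true))

  neighbours : Subset n → Subset n
  neighbours R = select (adjacentTo? R)

  grow : Subset n → Subset n
  grow R = R ∪ neighbours R

  saturate : ℕ → Subset n → Subset n
  saturate zero    R = R
  saturate (suc k) R with R ⊂? grow R
  ... | yes _ = saturate k (grow R)
  ... | no  _ = R

  component : Fin n → Subset n
  component u = saturate n ⁅ u ⁆

  stuck⇒closed : ∀ {R} → ¬ R ⊂ grow R → Closed H R
  stuck⇒closed {R} ¬grows {z} {w} z∈ e with w ∈? R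
  ... | yes w∈ = w∈
  ... | no  w∉ = ⊥-elim (¬grows ((λ {x} → p⊆p∪q (neighbours R)) , w , w∈grow , w∉))
    where
    w∈grow : w ∈ grow R
    w∈grow = q⊆p∪q R _ (from (∈-select⇔ (adjacentTo? R)) (z , z∈ , e))

  saturate-closed : ∀ k R → n < k + ∣ R ∣ → Closed H (saturate k R)
  saturate-closed zero    R bound = contradiction (∣p∣≤n R) (<⇒≱ bound)
  saturate-closed (suc k) R bound with R ⊂? grow R
  ... | no  ¬grows = stuck⇒closed ¬grows
  ... | yes grows  = saturate-closed k (grow R) (begin-strict
    n                  <⟨ bound ⟩
    suc k + ∣ R ∣      ≡⟨ sym (+-suc k ∣ R ∣) ⟩
    k + suc ∣ R ∣      ≤⟨ +-monoʳ-≤ k (p⊂q⇒∣p∣<∣q∣ grows) ⟩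
    k + ∣ grow R ∣     ∎)
    where open ≤-Reasoning

  saturate-⊇ : ∀ k R → R ⊆ saturate k R
  saturate-⊇ zero    R w∈ = w∈
  saturate-⊇ (suc k) R w∈ with R ⊂? grow R
  ... | yes _ = saturate-⊇ k (grow R) (p⊆p∪q _ w∈)
  ... | no  _ = w∈

  grow-sound : ∀ {u R} → (∀ {w} → w ∈ R → Reachable H u w) →
               ∀ {w} → w ∈ grow R → Reachable H u w
  grow-sound {R = R} sound w∈ with x∈p∪q⁻ R _ w∈
  ... | inj₁ w∈R = sound w∈R
  ... | inj₂ w∈N with to (∈-select⇔ (adjacentTo? R)) w∈N
  ...   | z , z∈R , e = sound z∈R ◅◅ edge e

  saturate-sound : ∀ {u} k R → (∀ {w} → w ∈ R → Reachable H u w) →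
                   ∀ {w} → w ∈ saturate k R → Reachable H u w
  saturate-sound zero    R sound = sound
  saturate-sound (suc k) R sound with R ⊂? grow R
  ... | yes _ = saturate-sound k (grow R) (grow-sound sound)
  ... | no  _ = sound

  component-closed : ∀ u → Closed H (component u)
  component-closed u =
    saturate-closed n ⁅ u ⁆ (m<m+n n (subst (0 <_) (sym (∣⁅x⁆∣≡1 u)) (s≤s z≤n)))

  ∈-component⇔ : ∀ u w → w ∈ component u ⇔ Reachable H u w
  ∈-component⇔ u w = mk⇔
    (saturate-sound n ⁅ u ⁆ (λ w∈ → subst (Reachable H u) (sym (x∈⁅y⁆⇒x≡y u w∈)) here))
    (closed-reach (component-closed u) (saturate-⊇ n ⁅ u ⁆ (x∈⁅x⁆ u)))

  reachable? : ∀ u w → Dec (Reachable H u w)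
  reachable? u w with w ∈? component u
  ... | yes w∈ = yes (to (∈-component⇔ u w) w∈)
  ... | no  w∉ = no (w∉ ∘ from (∈-component⇔ u w))

safe⇒α-preserved : ∀ (G : Graph n) u v → ¬ AlphaCriticalEdge G u v →
                   α (removeEdge G u v) ≡ α G
safe⇒α-preserved G u v safe =
  ≤-antisym (≮⇒≥ safe) (α-anti {H = removeEdge G u v} {G} (removeEdge-⊑ G u v))

α-removeEdge-swap : ∀ (G : Graph n) x y → α (removeEdge G x y) ≡ α (removeEdge G y x)
α-removeEdge-swap G x y =
  ≤-antisym (α-anti {H = removeEdge G y x} {removeEdge G x y} (removeEdge-swap G y x))
            (α-anti {H = removeEdge G x y} {removeEdge G y x} (removeEdge-swap G x y))

critical-after-safe-removal : ∀ (G : Graph n) {u v x y} → ¬ AlphaCriticalEdge G u v →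
                              AlphaCriticalEdge G x y →
                              AlphaCriticalEdge (removeEdge G u v) x y
critical-after-safe-removal G {u} {v} {x} {y} safe crit = begin-strict
  α (removeEdge G u v)                  ≡⟨ safe⇒α-preserved G u v safe ⟩
  α G                                   <⟨ crit ⟩
  α (removeEdge G x y)                  ≤⟨ α-anti {H = removeEdge (removeEdge G u v) x y} {removeEdge G x y}
                                             (removeEdge-mono {H = removeEdge G u v} {G} x y (removeEdge-⊑ G u v)) ⟩
  α (removeEdge (removeEdge G u v) x y) ∎
  where open ≤-Reasoning

stable-removeEdge⁻ : ∀ (K : Graph n) {x y S} → x ∉ S →
                     Stable (removeEdge K x y) S → Stable K S
stable-removeEdge⁻ K {x} {y} x∉S st {i} {j} i∈ j∈ with adj K i j in e
... | false = refl
... | true with removeEdge-edge K x y e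
...   | inj₁ kept                = trans (sym kept) (st i∈ j∈)
...   | inj₂ (inj₁ (refl , _))   = contradiction i∈ x∉S
...   | inj₂ (inj₂ (_ , refl))   = contradiction j∈ x∉S

-- A largest stable set S of K - xy splits into
-- S ∩ T and S ∖ T; a largest stable set M of K[T] together with S ∖ T is
-- stable in K, so αIn K T + |S ∖ T| ≤ α K < |S| ≤ αIn (K - xy) T + |S ∖ T|.
critical-restricts : ∀ (K : Graph n) (T : Subset n) {x y} → Closed K T → x ∈ T →
                     AlphaCriticalEdge K x y → αIn K T < αIn (removeEdge K x y) T
critical-restricts K T {x} {y} closed x∈T crit
  with α-attained (removeEdge K x y) | αIn-attained K T
... | S , stS , maxS | M , stM , M⊆T , maxM =
  +-cancelʳ-< ∣ outside ∣ (αIn K T) (αIn K-xy T) chain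
  where
  K-xy : Graph _
  K-xy = removeEdge K x y
  inside outside : Subset _
  inside  = S ∩ T
  outside = S ∩ ∁ T
  out∉T : ∀ {w} → w ∈ outside → w ∉ T
  out∉T w∈ = x∈∁p⇒x∉p (proj₂ (x∈p∩q⁻ S (∁ T) w∈))
  outside-stable : Stable K outside
  outside-stable = stable-removeEdge⁻ K (λ x∈ → out∉T x∈ x∈T)
                     (stable-⊆ K-xy (λ w∈ → proj₁ (x∈p∩q⁻ S (∁ T) w∈)) stS)
  cross : ∀ {i j} → i ∈ M → j ∈ outside → adj K i j ≡ false
  cross {i} {j} i∈ j∈ with adj K i j in e
  ... | false = refl
  ... | true  = contradiction (closed (M⊆T i∈) e) (out∉T j∈)
  union-bound : ∣ M ∣ + ∣ outside ∣ ≤ α K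
  union-bound = subst (_≤ α K) (∣p∪q∣≡∣p∣+∣q∣ M outside (λ i∈M i∈out → out∉T i∈out (M⊆T i∈M)))
                  (α-ub K (stable-∪ K stM outside-stable cross))
  inside-bound : ∣ inside ∣ ≤ αIn K-xy T
  inside-bound = αIn-ub K-xy T (stable-⊆ K-xy (λ w∈ → proj₁ (x∈p∩q⁻ S T w∈)) stS)
                   (λ w∈ → proj₂ (x∈p∩q⁻ S T w∈))
  chain : αIn K T + ∣ outside ∣ < αIn K-xy T + ∣ outside ∣
  chain = begin-strict
    αIn K T + ∣ outside ∣      ≤⟨ +-monoˡ-≤ ∣ outside ∣ maxM ⟩
    ∣ M ∣ + ∣ outside ∣        ≤⟨ union-bound ⟩
    α K                        <⟨ crit ⟩
    α K-xy                     ≤⟨ maxS ⟩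
    ∣ S ∣                      ≡⟨ ∣p∣≡∣p∩q∣+∣p∩∁q∣ S T ⟩
    ∣ inside ∣ + ∣ outside ∣   ≤⟨ +-monoˡ-≤ ∣ outside ∣ inside-bound ⟩
    αIn K-xy T + ∣ outside ∣   ∎
    where open ≤-Reasoning

pair? : ∀ {P : Fin n → Fin n → Set} → (∀ x y → Dec (P x y)) → Dec (∃₂ P)
pair? P? = any? λ x → any? λ y → P? x y

module Extremal {n} (G : Graph n) (connected : Connected G)
  (maximal : ∀ (H : Graph n) → Connected H → α H ≡ α G → F H ≤ F G) where

  SafeEdge : Fin n → Fin n → Set
  SafeEdge u v = adj G u v ≡ true × ¬ AlphaCriticalEdge G u v

  safeEdge? : ∀ u v → Dec (SafeEdge u v)
  safeEdge? u v = (adj G u v ≟ᵇ true) ×-dec ¬? (α G <? α (removeEdge G u v))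

  safe-swap : ∀ {u v} → SafeEdge u v → SafeEdge v u
  safe-swap {u} {v} (e , safe) =
    trans (Graph.sym G v u) e , safe ∘ subst (α G <_) (α-removeEdge-swap G v u)

  -- Every α-safe edge is a bridge: otherwise G - e would beat G.
  safe⇒bridge : ∀ {u v} → SafeEdge u v → ¬ Connected (removeEdge G u v)
  safe⇒bridge {u} {v} (e , safe) conn =
    <⇒≱ (F-removeEdge G u v e) (maximal _ conn (safe⇒α-preserved G u v safe))

  side : Fin n → Fin n → Subset n
  side u v = Component.component (removeEdge G u v) u

  ∈-side⇔ : ∀ {u v w} → w ∈ side u v ⇔ Reachable (removeEdge G u v) u w
  ∈-side⇔ {u} {v} {w} = Component.∈-component⇔ (removeEdge G u v) u w

  side-closed : ∀ {u v} → Closed (removeEdge G u v) (side u v)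
  side-closed {u} {v} = Component.component-closed (removeEdge G u v) u

  decomposition : ∀ {u v} → SafeEdge u v →
                  (∀ {x y} → x ∈ side u v → adj (removeEdge G u v) x y ≡ true →
                     AlphaCriticalEdge G x y) →
                  HasAlphaCriticalDecomposition G
  decomposition {u} {v} uv@(e , safe) all-critical =
    u , v , (e , safe⇒bridge uv) , safe , side u v , side-lookup , critical-on
    where
    side-lookup : ∀ w → (lookup (side u v) w ≡ true) ⇔ Reachable (removeEdge G u v) u w
    side-lookup w = mk⇔ (to ∈-side⇔ ∘ from ∈⇔lookup) (to ∈⇔lookup ∘ from ∈-side⇔)
    critical-on : AlphaCriticalOn (removeEdge G u v) (side u v)
    critical-on x y x∈ _ a =
      critical-restricts (removeEdge G u v) (side u v) side-closed (from ∈⇔lookup x∈)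
        (critical-after-safe-removal G safe (all-critical (from ∈⇔lookup x∈) a))

  -- A safe edge xy on the side of u, oriented so that x does not reach v in
  -- G - xy, has its side strictly inside that of u: walks from x in G - xy
  -- avoid uv, and y is on the side of u but not of x (xy is a bridge).
  side-shrinks : ∀ {u v x y} → SafeEdge x y → x ∈ side u v →
                 adj (removeEdge G u v) x y ≡ true →
                 ¬ Reachable (removeEdge G x y) x v → side x y ⊂ side u v
  side-shrinks {u} {v} {x} {y} xy x∈ a x↛v = inner , y , side-closed x∈ a , y∉
    where
    inner : side x y ⊆ side u v
    inner w∈ = from ∈-side⇔
      (to ∈-side⇔ x∈ ◅◅ avoid {H = removeEdge G x y} {G} (removeEdge-⊑ G x y) x↛v (to ∈-side⇔ w∈))
    y∉ : y ∉ side x y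
    y∉ y∈ = safe⇒bridge xy (reconnect G x y connected (to ∈-side⇔ y∈))

  smaller-side : ∀ {u v x y} → x ∈ side u v → adj (removeEdge G u v) x y ≡ true →
                 ¬ AlphaCriticalEdge G x y →
                 ∃₂ λ x′ y′ → SafeEdge x′ y′ × ∣ side x′ y′ ∣ < ∣ side u v ∣
  smaller-side {u} {v} {x} {y} x∈ a safe
    with Component.reachable? (removeEdge G x y) x v
  ... | no  x↛v = x , y , xy , p⊂q⇒∣p∣<∣q∣ (side-shrinks xy x∈ a x↛v)
    where
    xy : SafeEdge x y
    xy = removeEdge-⊑ G u v a , safe
  ... | yes x→v = y , x , safe-swap xy ,
                  p⊂q⇒∣p∣<∣q∣ (side-shrinks (safe-swap xy) (side-closed x∈ a) a′ y↛v)
    where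
    xy : SafeEdge x y
    xy = removeEdge-⊑ G u v a , safe
    a′ : adj (removeEdge G u v) y x ≡ true
    a′ = trans (Graph.sym (removeEdge G u v) y x) a
    -- y cannot also reach v, or x would reach y in G - xy.
    y↛v : ¬ Reachable (removeEdge G y x) y v
    y↛v y→v = safe⇒bridge xy (reconnect G x y connected
                (x→v ◅◅ reverse (reach-⊑ (removeEdge-swap G y x) y→v)))

  descend : ∀ k u v → SafeEdge u v → ∣ side u v ∣ < k → HasAlphaCriticalDecomposition G
  descend zero u v uv ()
  descend (suc k) u v uv bound
    with pair? (λ x y → (x ∈? side u v) ×-dec (adj (removeEdge G u v) x y ≟ᵇ true)
                          ×-dec ¬? (α G <? α (removeEdge G x y)))
  ... | yes (x , y , x∈ , a , safe) with smaller-side x∈ a safe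
  ...   | x′ , y′ , x′y′ , smaller = descend k x′ y′ x′y′ (<-≤-trans smaller (≤-pred bound))
  descend (suc k) u v uv bound | no none = decomposition uv λ {x} {y} x∈ a →
    decidable-stable (α G <? α (removeEdge G x y)) (λ safe → none (x , y , x∈ , a , safe))

lemma16 : (n : ℕ) (G : Graph n) → Connected G →
          (∀ (H : Graph n) → Connected H → α H ≡ α G → F H ≤ F G) →
          AlphaCritical G ⊎ HasAlphaCriticalDecomposition G
lemma16 n G connected maximal = dichotomy
  where
  open Extremal G connected maximal
  dichotomy : AlphaCritical G ⊎ HasAlphaCriticalDecomposition G
  dichotomy with pair? safeEdge?
  ... | yes (u , v , uv) = inj₂ (descend (suc ∣ side u v ∣) u v uv ≤-refl)
  ... | no  none         = inj₁ λ u v e →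
    decidable-stable (α G <? α (removeEdge G u v)) (λ safe → none (u , v , e , safe))
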